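{- Let $M\subseteq\mathbb{T}$ satisfy the standing hypothesis. The complete shell $\mathrm{shell}_{\oplus}(\rho^\forall_M)$ of the universal closure for $\oplus$ exists, and its set of fixpoints is the closure under arbitrary unions of the family $\{\ominus^n(X)\mid n\in\mathbb{N},\ X\text{ a fixpoint of }\rho^\forall_M\}$.
   Context: $\mathbb{T}$ is the set of traces $\langle i,\sigma\rangle$, $i\in\mathbb{Z}$, $\sigma:\mathbb{Z}\to\mathbb{S}$; $X_{\downarrow s}=\{\langle i,\sigma\rangle\in X\mid\sigma_i=s\}$; $\oplus(X)=\{\langle i,\sigma\rangle\mid\langle i+1,\sigma\rangle\in X\}$, $\ominus(X)=\{\langle i,\sigma\rangle\mid\langle i-1,\sigma\rangle\in X\}$, $\curvearrowleft(X)=\{\langle -i,\lambda k.\sigma_{ -k}\rangle\mid\langle i,\sigma\rangle\in X\}$. Standing hypothesis on $M$: (i) $|M_{\downarrow s}|>1$ for all $s$; (ii) $\oplus(M)=M=\ominus(M)$ and $\oplus(\curvearrowleft M)=\curvearrowleft M=\ominus(\curvearrowleft M)$. $\rho^\forall_M(X)=\{\langle i,\sigma\rangle\in M\mid M_{\downarrow\sigma_i}\subseteq X\}$. Upper closure operators on $\langle\wp(\mathbb{T}),\supseteq\rangle$: maps monotone w.r.t. $\subseteq$, idempotent, with $\rho(X)\subseteq X$; ordered by $\rho\sqsubseteq\eta$ iff $\rho(X)\supseteq\eta(X)$ for all $X$; identified with their sets of fixpoints. $\rho$ is complete for $f$ if $\rho\circ f=\rho\circ f\circ\rho$. The complete shell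 of $\rho$ for $f$ is the $\sqsubseteq$-greatest closure $\eta$ with $\eta\sqsubseteq\rho$ that is complete for $f$. -}

module Defs where

open import Level using (Level; suc; _⊔_)
open import Data.Nat using (ℕ; zero) renaming (suc to sucℕ)
open import Data.Integer using (ℤ; -_; _+_; _-_; 1ℤ)
open import Data.Product using (Σ; _×_; _,_; ∃; ∃-syntax)
open import Relation.Binary.PropositionalEquality using (_≡_)
open import Relation.Nullary using (¬_)
open import Relation.Unary using (Pred; _∈_; _⊆_; _≐_)

Trace : ∀ {a} → Set a → Set a
Trace S = ℤ × (ℤ → S)

TSet : ∀ {a} → Set a → Set (suc a)
TSet {a} S = Pred (Trace S) a

module _ {a} {S : Set a} where

  idx : Trace S → ℤ
  idx (i , σ) = i

  st : Trace S → ℤ → S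
  st (i , σ) = σ

  cur : Trace S → S
  cur (i , σ) = σ i

  -- equality of traces (as mathematical objects: pointwise on σ)
  _≈T_ : Trace S → Trace S → Set a
  (i , σ) ≈T (j , τ) = (i ≡ j) × (∀ k → σ k ≡ τ k)

  _↓_ : TSet S → S → TSet S
  (X ↓ s) t = (t ∈ X) × (cur t ≡ s)

  ⊕ : TSet S → TSet S
  ⊕ X (i , σ) = (i + 1ℤ , σ) ∈ X

  ⊖ : TSet S → TSet S
  ⊖ X (i , σ) = (i - 1ℤ , σ) ∈ X

  rev : Trace S → Trace S
  rev (i , σ) = (- i , λ k → σ (- k))

  -- ↶(X) = image of X under rev; since rev is an involution this is
  -- the preimage {t | rev t ∈ X}
  ↶ : TSet S → TSet S
  ↶ X t = rev t ∈ X

  iter : ℕ → (TSet S → TSet S) → TSet S → TSet S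
  iter zero f X = X
  iter (sucℕ n) f X = f (iter n f X)

  -- |M↓s| > 1 : there are two distinct traces in M↓s
  MoreThanOne : TSet S → Set a
  MoreThanOne Y = Σ (Trace S) λ t → Σ (Trace S) λ u → (t ∈ Y) × (u ∈ Y) × ¬ (t ≈T u)

  Standing : TSet S → Set a
  Standing M = (∀ (s : S) → MoreThanOne (M ↓ s))
             × (⊕ M ≐ M) × (⊖ M ≐ M)
             × (⊕ (↶ M) ≐ ↶ M) × (⊖ (↶ M) ≐ ↶ M)

  ρ∀ : TSet S → TSet S → TSet S
  ρ∀ M X t = (t ∈ M) × ((M ↓ cur t) ⊆ X)

  -- upper closure operators on ⟨℘(𝕋), ⊇⟩
  record UCO : Set (suc a) where
    field
      op        : TSet S → TSet S
      monotone  : ∀ {X Y} → X ⊆ Y → op X ⊆ op Y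
      idempotent : ∀ X → op (op X) ≐ op X
      reductive : ∀ X → op X ⊆ X

  _⊑_ : (TSet S → TSet S) → (TSet S → TSet S) → Set (suc a)
  ρ ⊑ η = ∀ X → η X ⊆ ρ X

  Complete : (TSet S → TSet S) → (TSet S → TSet S) → Set (suc a)
  Complete ρ f = ∀ X → ρ (f X) ≐ ρ (f (ρ X))

  IsShell : (TSet S → TSet S) → (TSet S → TSet S) → UCO → Set (suc a)
  IsShell f ρ η = (UCO.op η ⊑ ρ) × Complete (UCO.op η) f
                × (∀ (η′ : UCO) → UCO.op η′ ⊑ ρ → Complete (UCO.op η′) f
                     → UCO.op η′ ⊑ UCO.op η)

  Fix : (TSet S → TSet S) → TSet S → Set a
  Fix ρ X = ρ X ≐ X

  ⋃ : (I : Set a) → (I → TSet S) → TSet S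
  ⋃ I F t = Σ I λ i → t ∈ F i

  InUnionClosure : TSet S → TSet S → Set (suc a)
  InUnionClosure M X =
    Σ (Set a) λ I → Σ (I → ℕ) λ n → Σ (I → TSet S) λ Y →
      (∀ i → Fix (ρ∀ M) (Y i)) × (X ≐ ⋃ I (λ i → iter (n i) ⊖ (Y i)))

{-# OPTIONS --safe #-}
-- The shell is the interior operator of the basis {⊖ⁿ(M↓s)}: it sends X to the
-- union of the basic sets inside X, so its fixpoints are the unions of basic sets.
-- Since ⊖ is left adjoint to ⊕, the open sets (X ⊆ η X) of any ⊕-complete closure
-- η are closed under ⊖, and each M↓s, being ρ∀-fixed, is open for every η ⊑ ρ∀.
-- So every basic set is η-open, which makes the interior operator the greatest
-- such η. Conversely, the basis is closed under ⊖, which makes the interior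
-- operator ⊕-complete.
module Submission where

open import Defs
open import Data.Integer.Properties using (+-0-abelianGroup)
open import Algebra.Properties.AbelianGroup +-0-abelianGroup
  using (//-rightDividesˡ; //-rightDividesʳ)
open import Data.Integer using (_+_; _-_; 1ℤ)
open import Data.Nat using (ℕ; zero) renaming (suc to sucℕ)
open import Data.Product using (Σ; _×_; _,_; proj₁; proj₂)
open import Function.Bundles using (_⇔_; mk⇔)
open import Function.Construct.Composition using (_⇔-∘_)
open import Relation.Binary.PropositionalEquality using (_≡_; refl; sym; subst)
open import Relation.Unary using (_∈_; _⊆_; _≐_)

i+1-1≡i : ∀ i → i + 1ℤ - 1ℤ ≡ i
i+1-1≡i = //-rightDividesʳ 1ℤ

i-1+1≡i : ∀ i → i - 1ℤ + 1ℤ ≡ i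
i-1+1≡i = //-rightDividesˡ 1ℤ

module _ {a} {S : Set a} where

  ⊕-mono : (X Y : TSet S) → X ⊆ Y → ⊕ X ⊆ ⊕ Y
  ⊕-mono X Y X⊆Y {i , σ} = X⊆Y

  ⊖⊆⇒⊆⊕ : (X Y : TSet S) → ⊖ X ⊆ Y → X ⊆ ⊕ Y
  ⊖⊆⇒⊆⊕ X Y ⊖X⊆Y {i , σ} x = ⊖X⊆Y (subst (λ j → (j , σ) ∈ X) (sym (i+1-1≡i i)) x)

  ⊆⊕⇒⊖⊆ : (X Y : TSet S) → X ⊆ ⊕ Y → ⊖ X ⊆ Y
  ⊆⊕⇒⊖⊆ X Y X⊆⊕Y {i , σ} x = subst (λ j → (j , σ) ∈ Y) (i-1+1≡i i) (X⊆⊕Y x)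

  Open : UCO {S = S} → TSet S → Set a
  Open η X = X ⊆ UCO.op η X

  module _ (η : UCO {S = S}) where
    open UCO η

    Fix⇔Open : (X : TSet S) → Fix op X ⇔ Open η X
    Fix⇔Open X = mk⇔ proj₂ (λ X-open → (λ {t} → reductive X {t}) , X-open)

    Fix⇒Open : {ρ : TSet S → TSet S} {X : TSet S} → op ⊑ ρ → Fix ρ X → Open η X
    Fix⇒Open {X = X} op⊑ρ (_ , X⊆ρX) x = op⊑ρ X (X⊆ρX x)

    ⋃-Open : {I : Set a} {F : I → TSet S} {X : TSet S} →
             (∀ i → Open η (F i)) → X ≐ ⋃ I F → Open η X
    ⋃-Open F-open (X⊆⋃F , ⋃F⊆X) x with X⊆⋃F x
    ... | i , y = monotone (λ z → ⋃F⊆X (i , z)) (F-open i y)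

    ⊖-Open : Complete op ⊕ → {X : TSet S} → Open η X → Open η (⊖ X)
    ⊖-Open complete {X} X-open = ⊆⊕⇒⊖⊆ X (op (⊖ X)) X⊆⊕op⊖X
      where
      X⊆⊕op⊖X : X ⊆ ⊕ (op (⊖ X))
      X⊆⊕op⊖X x = reductive _ (proj₁ (complete (⊖ X))
                                 (monotone (⊖⊆⇒⊆⊕ X (⊖ X) (λ y → y)) (X-open x)))

    iter⊖-Open : Complete op ⊕ → ∀ n {X : TSet S} → Open η X → Open η (iter n ⊖ X)
    iter⊖-Open complete zero     X-open = X-open
    iter⊖-Open complete (sucℕ n) X-open = ⊖-Open complete (iter⊖-Open complete n X-open)

  module _ {I : Set a} (B : I → TSet S) where

    interior : TSet S → TSet S
    interior X t = Σ I λ i → (t ∈ B i) × (B i ⊆ X)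

    interior-mono : {X Y : TSet S} → X ⊆ Y → interior X ⊆ interior Y
    interior-mono X⊆Y (i , t∈Bi , Bi⊆X) = i , t∈Bi , λ u → X⊆Y (Bi⊆X u)

    interior-reductive : ∀ X → interior X ⊆ X
    interior-reductive X (i , t∈Bi , Bi⊆X) = Bi⊆X t∈Bi

    basic-⊆-interior : ∀ i → B i ⊆ interior (B i)
    basic-⊆-interior i t∈Bi = i , t∈Bi , λ u → u

    interiorUCO : UCO
    interiorUCO = record
      { op         = interior
      ; monotone   = interior-mono
      ; idempotent = λ X → interior-reductive (interior X)
                         , λ { (i , t∈Bi , Bi⊆X) → i , t∈Bi , λ u → i , u , Bi⊆X }
      ; reductive  = interior-reductive
      }

    Open-interior⇒⋃basic : {X : TSet S} → Open interiorUCO X →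
                           X ≐ ⋃ (Σ I λ i → B i ⊆ X) (λ j → B (proj₁ j))
    Open-interior⇒⋃basic X-open =
        (λ x → let (i , t∈Bi , Bi⊆X) = X-open x in (i , Bi⊆X) , t∈Bi)
      , λ { ((i , Bi⊆X) , t∈Bi) → Bi⊆X t∈Bi }

    interior-greatest : (η : UCO {S = S}) → (∀ i → Open η (B i)) → UCO.op η ⊑ interior
    interior-greatest η B-open X (i , t∈Bi , Bi⊆X) = UCO.monotone η Bi⊆X (B-open i t∈Bi)

    interior-complete : (∀ i → Open interiorUCO (⊖ (B i))) → Complete interior ⊕
    interior-complete ⊖B-open X =
      ⊆-shift , interior-mono (λ {t} → ⊕-mono (interior X) X (interior-reductive X) {t})
      where
      ⊆-shift : interior (⊕ X) ⊆ interior (⊕ (interior X))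
      ⊆-shift (i , t∈Bi , Bi⊆⊕X) = i , t∈Bi , ⊖⊆⇒⊆⊕ (B i) (interior X) ⊖Bi⊆interiorX
        where
        ⊖Bi⊆interiorX : ⊖ (B i) ⊆ interior X
        ⊖Bi⊆interiorX u = interior-mono (⊆⊕⇒⊖⊆ (B i) X Bi⊆⊕X) (⊖B-open i u)

module _ {a} {S : Set a} (M : TSet S) where

  shiftedFibres : ℕ × S → TSet S
  shiftedFibres (n , s) = iter n ⊖ (M ↓ s)

  shell : UCO
  shell = interiorUCO shiftedFibres

  ↓-Fix : ∀ s → Fix (ρ∀ M) (M ↓ s)
  ↓-Fix s = (λ (t∈M , M↓⊆) → M↓⊆ (t∈M , refl))
          , λ { (t∈M , refl) → t∈M , λ (u∈M , u≡) → u∈M , u≡ }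

  shell⊑ρ∀ : UCO.op shell ⊑ ρ∀ M
  shell⊑ρ∀ X {t} (t∈M , M↓⊆X) = (zero , cur t) , (t∈M , refl) , M↓⊆X

  shell-complete : Complete (UCO.op shell) ⊕
  shell-complete = interior-complete shiftedFibres
    λ (n , s) → basic-⊆-interior shiftedFibres (sucℕ n , s)

  shell-greatest : (η : UCO) → UCO.op η ⊑ ρ∀ M → Complete (UCO.op η) ⊕ →
                   UCO.op η ⊑ UCO.op shell
  shell-greatest η η⊑ρ∀ complete = interior-greatest shiftedFibres η
    λ (n , s) → iter⊖-Open η complete n (Fix⇒Open η η⊑ρ∀ (↓-Fix s))

  Open-shell⇔InUnionClosure : ∀ X → Open shell X ⇔ InUnionClosure M X
  Open-shell⇔InUnionClosure X = mk⇔ to from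
    where
    to : Open shell X → InUnionClosure M X
    to X-open = _ , (λ ((n , _) , _) → n) , (λ ((_ , s) , _) → M ↓ s)
              , (λ ((_ , s) , _) → ↓-Fix s)
              , Open-interior⇒⋃basic shiftedFibres X-open

    from : InUnionClosure M X → Open shell X
    from (_ , n , _ , Y-fix , X≐⋃) = ⋃-Open shell
      (λ i → iter⊖-Open shell shell-complete (n i) (Fix⇒Open shell shell⊑ρ∀ (Y-fix i)))
      X≐⋃

theorem9 : ∀ {a} {S : Set a} (M : TSet S) → Standing M →
    Σ UCO λ η → IsShell ⊕ (ρ∀ M) η
    × (∀ (X : TSet S) → Fix (UCO.op η) X ⇔ InUnionClosure M X)
theorem9 M _ = shell M
             , (shell⊑ρ∀ M , shell-complete M , shell-greatest M)
             , λ X → Open-shell⇔InUnionClosure M X ⇔-∘ Fix⇔Open (shell M) X
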